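{- Let $d_1,d_2,d_3$ be positive integers and $0\le m\le 2$ with $3\mid d_1+d_2+d_3+m+1$, and let $F$ be the vertex-disjoint union of $B(d_1,m,d_2)$ and a star with $d_3$ edges. Let $\chi$ be a $\mathbb{Z}_3$-coloring of the edges of $K_{d_1+d_2+d_3+m+3}$ with $\alpha_{C_4}(\chi)\ge 1$ such that there is an alternating $4$-cycle $C$ for which the coloring restricted to $K_{d_1+d_2+d_3+m+3}-V(C)$ is not monochromatic. Then $K_{d_1+d_2+d_3+m+3}$ contains a copy of $F$ whose edge colors sum to $0$ in $\mathbb{Z}_3$.
   Context: $B(d_1,m,d_2)$ is the tree consisting of two vertices $p_1,p_2$ joined by a path with $m$ internal vertices, where $p_i$ additionally has $d_i$ leaf neighbors. For a $\mathbb{Z}_3$-coloring $\chi$ of a complete graph, a $4$-cycle is alternating if the sums of the colors on its two perfect matchings are distinct, and $\alpha_{C_4}(\chi)$ is the maximum number of pairwise vertex-disjoint alternating $4$-cycles. -}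

module Defs where

open import Data.Nat using (ℕ; zero; suc; _+_; _%_; _<_)
open import Data.Fin using (Fin; toℕ)
open import Data.List using (List; map; upTo; _++_)
open import Data.Nat.ListAction using (sum)
open import Data.Product using (_×_; _,_; ∃; ∃-syntax; Σ-syntax)
open import Relation.Binary.PropositionalEquality using (_≡_; _≢_)

-- A Z₃-colouring of the edges of the complete graph K_n:
-- a symmetric assignment of a colour in Fin 3 ≅ ℤ₃ to each pair of vertices
-- (values on the diagonal are irrelevant: they are never used on edges).
record Colouring (n : ℕ) : Set where
  field
    col  : Fin n → Fin n → Fin 3
    symm : ∀ u v → col u v ≡ col v u
open Colouring public

Alternating : {n : ℕ} → Colouring n → Fin n → Fin n → Fin n → Fin n → Set
Alternating χ a b c d =
  (a ≢ b) × (a ≢ c) × (a ≢ d) × (b ≢ c) × (b ≢ d) × (c ≢ d) ×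
  (((toℕ (col χ a b) + toℕ (col χ c d)) % 3) ≢ ((toℕ (col χ b c) + toℕ (col χ d a)) % 3))

-- α_{C₄}(χ) ≥ 1 : there is at least one alternating 4-cycle
-- (a single 4-cycle is trivially a vertex-disjoint family).
αC4≥1 : {n : ℕ} → Colouring n → Set
αC4≥1 χ = ∃[ a ] ∃[ b ] ∃[ c ] ∃[ d ] Alternating χ a b c d

Outside : {n : ℕ} → Fin n → Fin n → Fin n → Fin n → Fin n → Set
Outside a b c d v = (v ≢ a) × (v ≢ b) × (v ≢ c) × (v ≢ d)

NotMonoOutside : {n : ℕ} → Colouring n → Fin n → Fin n → Fin n → Fin n → Set
NotMonoOutside χ a b c d =
  ∃[ u ] ∃[ v ] ∃[ x ] ∃[ y ]
    (Outside a b c d u × Outside a b c d v × Outside a b c d x × Outside a b c d y ×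
     u ≢ v × x ≢ y × col χ u v ≢ col χ x y)

-- The forest F = B(d₁,m,d₂) ⊔ K_{1,d₃}, with vertex set {0,…,d₁+d₂+d₃+m+2}:
--   p₁ = 0, internal path vertices 1,…,m, p₂ = m+1;
--   leaves of p₁ : m+2+j            (j < d₁)
--   leaves of p₂ : m+2+d₁+j         (j < d₂)
--   star centre  : s = m+2+d₁+d₂, star leaves s+1+j  (j < d₃).
Fedges : ℕ → ℕ → ℕ → ℕ → List (ℕ × ℕ)
Fedges d₁ m d₂ d₃ =
     map (λ i → (i , suc i)) (upTo (suc m))
  ++ map (λ j → (0 , m + 2 + j)) (upTo d₁)
  ++ map (λ j → (suc m , m + 2 + d₁ + j)) (upTo d₂)
  ++ map (λ j → (m + 2 + d₁ + d₂ , m + 2 + d₁ + d₂ + 1 + j)) (upTo d₃)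

Fsize : ℕ → ℕ → ℕ → ℕ → ℕ
Fsize d₁ m d₂ d₃ = d₁ + d₂ + d₃ + m + 3

IsCopy : {n : ℕ} → ℕ → (ℕ → Fin n) → Set
IsCopy N f = ∀ u v → u < N → v < N → f u ≡ f v → u ≡ v

copyColourSum : {n : ℕ} → Colouring n → (ℕ → Fin n) → List (ℕ × ℕ) → ℕ
copyColourSum χ f es = sum (map (λ e → toℕ (col χ (f (Data.Product.proj₁ e)) (f (Data.Product.proj₂ e)))) es)

{-# OPTIONS --safe #-}
module Submission where

-- Copies of F span K_n, so a copy is a bijection between V(F) and the vertices, and its weight
-- is the sum of its edge colours in ℤ₃. Hang b and d of the alternating cycle as leaves of a
-- and c: exchanging b and d shifts the weight by δ = (ad + cb) − (ab + cd) ≠ 0. So two such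
-- copies of different weight already yield a copy of weight 0, because s and s + δ both avoid 0
-- for only one residue s. Two copies of different weight come from exchanging two vertices p, q
-- off the cycle with col(w,p) ≠ col(w,q). If the spine has an internal vertex (m ≥ 1), p and q
-- can be placed so that the exchange shifts the weight by col(q,w) − col(p,w). If m = 0, either
-- some exchange already works, or every vertex y off {a,b,c,d,p,q} has col(y,p) − col(y,q) equal
-- to t = col(a,p) − col(a,q) ≠ 0; then moving p from a leaf to a centre with k such neighbours
-- shifts the weight by k·t, and 3 ∣ d₁ + d₂ + d₃ + 1 provides a centre with 3 ∤ k.

open import Data.Fin as Fin using (Fin; toℕ; fromℕ; fromℕ<; inject₁)
open import Data.Fin.Patterns using (0F; 1F; 2F; 3F; 4F; 5F; 6F; 7F)
open import Data.Fin.Permutation.Components using (transpose; transpose-inverse)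
open import Data.Fin.Properties
  using (toℕ-fromℕ<; toℕ-injective; toℕ<n; toℕ-inject₁; toℕ-fromℕ; suc-injective; all?; _≟_)
open import Data.List using (List; []; _∷_; foldr; map; upTo; applyUpTo; tabulate; filter; _++_)
open import Data.List.Properties using (map-++; map-upTo; map-tabulate; tabulate-cong; map-∘; map-cong-local)
open import Data.List.Relation.Unary.All as All using (All; []; _∷_)
open import Data.Nat as ℕ using (ℕ; zero; suc; _+_; _*_; _%_; _<_; _≤_; z≤n; s≤s; NonZero)
open import Data.Nat.DivMod using (_mod_; %-distribˡ-+; m<n⇒m%n≡m; [m+n]%n≡m%n; m*n%n≡0)
open import Data.Nat.Divisibility using (_∣_; divides)
open import Data.Nat.ListAction using (sum)
open import Data.Nat.Properties
  using (+-comm; +-identityʳ; +-cancelˡ-≡; ≤-refl; ≤-trans; ≤-reflexive; m≤m+n; m≤n+m; +-monoʳ-<;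
         <-≤-trans; m≤n⇒m<n∨m≡n; <-cmp; <⇒≢)
open import Data.Nat.Tactic.RingSolver using (solve-∀)
open import Data.Product using (Σ-syntax; ∃-syntax; _,_; _×_; proj₁; proj₂)
open import Data.Product.Properties using (≡-dec)
open import Data.Sum using (_⊎_; inj₁; inj₂; [_,_]′; map₂)
open import Data.Unit using (⊤)
open import Data.Vec using (Vec; []; _∷_; lookup)
open import Data.Vec.Functional using () renaming (_∷_ to _∷ᵛ_)
open import Data.Vec.Relation.Unary.All using ([]; _∷_)
open import Data.Vec.Relation.Unary.AllPairs using ([]; _∷_; allPairs?)
open import Data.Vec.Relation.Unary.Unique.Propositional.Properties using (lookup-injective)
open import Function using (_∘_; id; Injective)
open import Relation.Binary.Definitions using (DecidableEquality; tri<; tri≈; tri>)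
open import Relation.Binary.PropositionalEquality
open import Relation.Nullary using (¬_; yes; no; ¬?; contradiction)
open import Relation.Nullary.Decidable using (True; toWitness; from-yes; _→-dec_; _⊎-dec_; _×-dec_)
open import Relation.Unary using (Decidable)

open import Defs

applyUpTo-tabulate : ∀ {A : Set} (f : ℕ → A) n → applyUpTo f n ≡ tabulate {n = n} (f ∘ toℕ)
applyUpTo-tabulate f zero    = refl
applyUpTo-tabulate f (suc n) = cong (f 0 ∷_) (applyUpTo-tabulate (f ∘ suc) n)

⊎-all : ∀ {A : Set} {l} {B : Fin l → Set} → (∀ j → A ⊎ B j) → A ⊎ (∀ j → B j)
⊎-all {l = zero}  choice = inj₂ λ ()
⊎-all {l = suc l} choice with choice Fin.zero | ⊎-all (choice ∘ Fin.suc)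
... | inj₁ x | _      = inj₁ x
... | inj₂ _ | inj₁ x = inj₁ x
... | inj₂ b | inj₂ bs = inj₂ λ { Fin.zero → b ; (Fin.suc j) → bs j }

lookup-injective-by-decision : ∀ {A : Set} {k} (_≟ᴬ_ : DecidableEquality A) (xs : Vec A k) →
  True (allPairs? (λ x y → ¬? (x ≟ᴬ y)) xs) → Injective _≡_ _≡_ (lookup xs)
lookup-injective-by-decision _≟ᴬ_ xs distinct = lookup-injective (toWitness distinct) _ _

-- Residues modulo 3

ℤ₃ : Set
ℤ₃ = Fin 3

[_]₃ : ℕ → ℤ₃
[ n ]₃ = n mod 3

toℕ-[]₃ : ∀ n → toℕ [ n ]₃ ≡ n % 3
toℕ-[]₃ n = toℕ-fromℕ< _

[toℕ]₃ : ∀ (x : ℤ₃) → [ toℕ x ]₃ ≡ x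
[toℕ]₃ x = toℕ-injective (trans (toℕ-[]₃ (toℕ x)) (m<n⇒m%n≡m (toℕ<n x)))

[3+]₃ : ∀ n → [ 3 + n ]₃ ≡ [ n ]₃
[3+]₃ n = toℕ-injective (trans (toℕ-[]₃ (3 + n))
  (trans (cong (_% 3) (+-comm 3 n)) (trans ([m+n]%n≡m%n n 3) (sym (toℕ-[]₃ n)))))

infixl 6 _+₃_ _-₃_
infixr 7 _·_

-- Opaque, so that unification treats sums in ℤ₃ as rigid instead of unfolding _mod_.
opaque
  _+₃_ : ℤ₃ → ℤ₃ → ℤ₃
  x +₃ y = [ toℕ x + toℕ y ]₃

-₃_ : ℤ₃ → ℤ₃
-₃ 0F = 0F
-₃ 1F = 2F
-₃ 2F = 1F

_-₃_ : ℤ₃ → ℤ₃ → ℤ₃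
x -₃ y = x +₃ (-₃ y)

Σ₃ : List ℤ₃ → ℤ₃
Σ₃ = foldr _+₃_ 0F

_·_ : ℕ → ℤ₃ → ℤ₃
zero  · x = 0F
suc n · x = x +₃ n · x

opaque
  unfolding _+₃_

  toℕ-+₃ : ∀ x y → toℕ (x +₃ y) ≡ (toℕ x + toℕ y) % 3
  toℕ-+₃ x y = toℕ-[]₃ (toℕ x + toℕ y)

  []₃-+ : ∀ m n → [ m + n ]₃ ≡ [ m ]₃ +₃ [ n ]₃
  []₃-+ m n = toℕ-injective (begin
    toℕ [ m + n ]₃                 ≡⟨ toℕ-[]₃ (m + n) ⟩
    (m + n) % 3                    ≡⟨ %-distribˡ-+ m n 3 ⟩
    (m % 3 + n % 3) % 3            ≡⟨ cong₂ (λ x y → (x + y) % 3) (toℕ-[]₃ m) (toℕ-[]₃ n) ⟨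
    (toℕ [ m ]₃ + toℕ [ n ]₃) % 3  ≡⟨ toℕ-[]₃ (toℕ [ m ]₃ + toℕ [ n ]₃) ⟨
    toℕ ([ m ]₃ +₃ [ n ]₃)         ∎)
    where open ≡-Reasoning

  +₃-comm : ∀ x y → x +₃ y ≡ y +₃ x
  +₃-comm = from-yes (all? λ x → all? λ y → x +₃ y ≟ y +₃ x)

  +₃-identityʳ : ∀ x → x +₃ 0F ≡ x
  +₃-identityʳ = from-yes (all? λ x → x +₃ 0F ≟ x)

  +₃-assoc : ∀ x y z → (x +₃ y) +₃ z ≡ x +₃ (y +₃ z)
  +₃-assoc = from-yes (all? λ x → all? λ y → all? λ z → (x +₃ y) +₃ z ≟ x +₃ (y +₃ z))

  +₃-interchange : ∀ w x y z → (w +₃ x) +₃ (y +₃ z) ≡ (w +₃ y) +₃ (x +₃ z)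
  +₃-interchange = from-yes (all? λ w → all? λ x → all? λ y → all? λ z →
    (w +₃ x) +₃ (y +₃ z) ≟ (w +₃ y) +₃ (x +₃ z))

  Σ₃-swap : ∀ x y → Σ₃ (x ∷ y ∷ []) ≡ Σ₃ (y ∷ x ∷ [])
  Σ₃-swap = from-yes (all? λ x → all? λ y → Σ₃ (x ∷ y ∷ []) ≟ Σ₃ (y ∷ x ∷ []))

  one-term-differs₂ : ∀ u v x → u ≢ v → Σ₃ (u ∷ x ∷ []) ≢ Σ₃ (v ∷ x ∷ [])
  one-term-differs₂ = from-yes (all? λ u → all? λ v → all? λ x →
    ¬? (u ≟ v) →-dec ¬? (Σ₃ (u ∷ x ∷ []) ≟ Σ₃ (v ∷ x ∷ [])))

  one-term-differs₃ : ∀ u v x y → u ≢ v → Σ₃ (x ∷ u ∷ y ∷ []) ≢ Σ₃ (y ∷ v ∷ x ∷ [])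
  one-term-differs₃ = from-yes (all? λ u → all? λ v → all? λ x → all? λ y →
    ¬? (u ≟ v) →-dec ¬? (Σ₃ (x ∷ u ∷ y ∷ []) ≟ Σ₃ (y ∷ v ∷ x ∷ [])))

  shifts-differ : ∀ s₁ s₂ x y → s₂ +₃ x ≡ s₁ +₃ y → x ≢ y → s₁ ≢ s₂
  shifts-differ = from-yes (all? λ s₁ → all? λ s₂ → all? λ x → all? λ y →
    (s₂ +₃ x ≟ s₁ +₃ y) →-dec ¬? (x ≟ y) →-dec ¬? (s₁ ≟ s₂))

  -- For x ≢ y, s and s + (y − x) both avoid 0 for a single residue s only.
  two-shifts : ∀ s₁ s₁′ s₂ s₂′ x y → x ≢ y → s₁ ≢ s₂ →
               s₁′ +₃ x ≡ s₁ +₃ y → s₂′ +₃ x ≡ s₂ +₃ y →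
               s₁ ≡ 0F ⊎ s₁′ ≡ 0F ⊎ s₂ ≡ 0F ⊎ s₂′ ≡ 0F
  two-shifts = from-yes (all? λ s₁ → all? λ s₁′ → all? λ s₂ → all? λ s₂′ → all? λ x → all? λ y →
    ¬? (x ≟ y) →-dec ¬? (s₁ ≟ s₂) →-dec
    (s₁′ +₃ x ≟ s₁ +₃ y) →-dec (s₂′ +₃ x ≟ s₂ +₃ y) →-dec
    ((s₁ ≟ 0F) ⊎-dec (s₁′ ≟ 0F) ⊎-dec (s₂ ≟ 0F) ⊎-dec (s₂′ ≟ 0F)))

  tilt-from-balance : ∀ u u′ x x′ →
                      Σ₃ (u′ ∷ x ∷ []) ≡ Σ₃ (u ∷ x′ ∷ []) → x ≡ x′ +₃ (u -₃ u′)
  tilt-from-balance = from-yes (all? λ u → all? λ u′ → all? λ x → all? λ x′ →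
    (Σ₃ (u′ ∷ x ∷ []) ≟ Σ₃ (u ∷ x′ ∷ [])) →-dec (x ≟ x′ +₃ (u -₃ u′)))

  +₃-difference : ∀ x y → x ≡ y +₃ (x -₃ y)
  +₃-difference = from-yes (all? λ x → all? λ y → x ≟ y +₃ (x -₃ y))

  shift-≢ : ∀ y t → t ≢ 0F → y +₃ t ≢ y
  shift-≢ = from-yes (all? λ y → all? λ t → ¬? (t ≟ 0F) →-dec ¬? (y +₃ t ≟ y))

  Σ₃-shift₂ : ∀ u T t → Σ₃ (u ∷ (T +₃ t) ∷ []) ≡ Σ₃ (u ∷ T ∷ []) +₃ t
  Σ₃-shift₂ = from-yes (all? λ u → all? λ T → all? λ t →
    Σ₃ (u ∷ (T +₃ t) ∷ []) ≟ Σ₃ (u ∷ T ∷ []) +₃ t)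

  Σ₃-shift₃ : ∀ x u T κ t →
              Σ₃ ((x +₃ κ) ∷ u ∷ (T +₃ t) ∷ []) ≡ Σ₃ (x ∷ u ∷ T ∷ []) +₃ (κ +₃ t)
  Σ₃-shift₃ = from-yes (all? λ x → all? λ u → all? λ T → all? λ κ → all? λ t →
    Σ₃ ((x +₃ κ) ∷ u ∷ (T +₃ t) ∷ []) ≟ Σ₃ (x ∷ u ∷ T ∷ []) +₃ (κ +₃ t))

  last-residue : ∀ r₁ r₂ r₃ →
                 r₁ +₃ r₂ +₃ (1F +₃ r₃) +₃ 0F +₃ 1F ≡ 0F → r₃ ≡ 0F → r₁ ≡ 0F → r₂ ≢ 0F
  last-residue = from-yes (all? λ r₁ → all? λ r₂ → all? λ r₃ →
    (r₁ +₃ r₂ +₃ (1F +₃ r₃) +₃ 0F +₃ 1F ≟ 0F) →-dec (r₃ ≟ 0F) →-dec (r₁ ≟ 0F) →-dec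
    ¬? (r₂ ≟ 0F))

  thrice-cancels : ∀ x y → x +₃ (x +₃ (x +₃ y)) ≡ y
  thrice-cancels = from-yes (all? λ x → all? λ y → x +₃ (x +₃ (x +₃ y)) ≟ y)

  ·-small-nonzero : ∀ x → x ≢ 0F → 1 · x ≢ 0F × 2 · x ≢ 0F
  ·-small-nonzero = from-yes (all? λ x →
    ¬? (x ≟ 0F) →-dec (¬? (1 · x ≟ 0F) ×-dec ¬? (2 · x ≟ 0F)))

≢-by-shift : ∀ {x y t} → x ≡ y +₃ t → t ≢ 0F → x ≢ y
≢-by-shift {y = y} {t} x≡y+t t≢0 x≡y = shift-≢ y t t≢0 (trans (sym x≡y+t) x≡y)

·-nonzero : ∀ l x → x ≢ 0F → [ l ]₃ ≢ 0F → l · x ≢ 0F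
·-nonzero 0                   x x≢0 l≢0 = contradiction refl l≢0
·-nonzero 1                   x x≢0 l≢0 = proj₁ (·-small-nonzero x x≢0)
·-nonzero 2                   x x≢0 l≢0 = proj₂ (·-small-nonzero x x≢0)
·-nonzero (suc (suc (suc l))) x x≢0 l≢0 =
  ·-nonzero l x x≢0 (l≢0 ∘ trans ([3+]₃ l)) ∘ trans (sym (thrice-cancels x (l · x)))

residue-of-multiple : ∀ {x} → 3 ∣ x → [ x ]₃ ≡ 0F
residue-of-multiple (divides q refl) = toℕ-injective (trans (toℕ-[]₃ (q * 3)) (m*n%n≡0 q 3))

Σ₃-tabulate-shift : ∀ {l} (f g : Fin l → ℤ₃) κ → (∀ j → f j ≡ g j +₃ κ) →
                    Σ₃ (tabulate f) ≡ Σ₃ (tabulate g) +₃ l · κ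
Σ₃-tabulate-shift {zero}  f g κ f≡g+κ = sym (+₃-identityʳ 0F)
Σ₃-tabulate-shift {suc l} f g κ f≡g+κ = begin
  f Fin.zero +₃ Σ₃ (tabulate (f ∘ Fin.suc))
    ≡⟨ cong₂ _+₃_ (f≡g+κ Fin.zero)
                  (Σ₃-tabulate-shift (f ∘ Fin.suc) (g ∘ Fin.suc) κ (f≡g+κ ∘ Fin.suc)) ⟩
  (g Fin.zero +₃ κ) +₃ (Σ₃ (tabulate (g ∘ Fin.suc)) +₃ l · κ)
    ≡⟨ +₃-interchange (g Fin.zero) κ _ (l · κ) ⟩
  (g Fin.zero +₃ Σ₃ (tabulate (g ∘ Fin.suc))) +₃ (κ +₃ l · κ)  ∎
  where open ≡-Reasoning

Σ₃-++ : ∀ xs ys → Σ₃ (xs ++ ys) ≡ Σ₃ xs +₃ Σ₃ ys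
Σ₃-++ []       ys = sym (trans (+₃-comm 0F (Σ₃ ys)) (+₃-identityʳ (Σ₃ ys)))
Σ₃-++ (x ∷ xs) ys = trans (cong (x +₃_) (Σ₃-++ xs ys)) (sym (+₃-assoc x (Σ₃ xs) (Σ₃ ys)))

Σ₃-filter-exchange : ∀ {A : Set} {P : A → Set} (P? : Decidable P) (α β : A → ℤ₃) →
                     (∀ x → ¬ P x → α x ≡ β x) → ∀ xs →
                     Σ₃ (map β xs) +₃ Σ₃ (map α (filter P? xs))
                       ≡ Σ₃ (map α xs) +₃ Σ₃ (map β (filter P? xs))
Σ₃-filter-exchange P? α β α≡β [] = refl
Σ₃-filter-exchange P? α β α≡β (x ∷ xs) with P? x | Σ₃-filter-exchange P? α β α≡β xs
... | yes _ | ih = begin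
  (β x +₃ B) +₃ (α x +₃ A′)  ≡⟨ +₃-interchange (β x) B (α x) A′ ⟩
  (β x +₃ α x) +₃ (B +₃ A′)  ≡⟨ cong₂ _+₃_ (+₃-comm (β x) (α x)) ih ⟩
  (α x +₃ β x) +₃ (A +₃ B′)  ≡⟨ +₃-interchange (α x) (β x) A B′ ⟩
  (α x +₃ A) +₃ (β x +₃ B′)  ∎
  where
  open ≡-Reasoning
  A A′ B B′ : ℤ₃
  A = Σ₃ (map α xs); A′ = Σ₃ (map α (filter P? xs))
  B = Σ₃ (map β xs); B′ = Σ₃ (map β (filter P? xs))
... | no ¬Px | ih = begin
  (β x +₃ B) +₃ A′  ≡⟨ +₃-assoc (β x) B A′ ⟩
  β x +₃ (B +₃ A′)  ≡⟨ cong₂ _+₃_ (sym (α≡β x ¬Px)) ih ⟩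
  α x +₃ (A +₃ B′)  ≡⟨ +₃-assoc (α x) A B′ ⟨
  (α x +₃ A) +₃ B′  ∎
  where
  open ≡-Reasoning
  A A′ B B′ : ℤ₃
  A = Σ₃ (map α xs); A′ = Σ₃ (map α (filter P? xs))
  B = Σ₃ (map β xs); B′ = Σ₃ (map β (filter P? xs))

Σ₃-pair : ∀ x y → Σ₃ (x ∷ y ∷ []) ≡ x +₃ y
Σ₃-pair x y = cong (x +₃_) (+₃-identityʳ y)

[sum]₃ : ∀ (cs : List ℤ₃) → [ sum (map toℕ cs) ]₃ ≡ Σ₃ cs
[sum]₃ []       = refl
[sum]₃ (c ∷ cs) =
  trans ([]₃-+ (toℕ c) (sum (map toℕ cs))) (cong₂ _+₃_ ([toℕ]₃ c) ([sum]₃ cs))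

-- Transpositions and prescribed copies

module _ {n : ℕ} where

  transpose-fst : ∀ (i j : Fin n) → transpose i j i ≡ j
  transpose-fst i j with i ≟ i
  ... | yes _  = refl
  ... | no i≢i = contradiction refl i≢i

  transpose-snd : ∀ (i j : Fin n) → transpose i j j ≡ i
  transpose-snd i j with j ≟ i
  ... | yes j≡i = j≡i
  ... | no _ with j ≟ j
  ...   | yes _  = refl
  ...   | no j≢j = contradiction refl j≢j

  transpose-fixes : ∀ {i j k : Fin n} → k ≢ i → k ≢ j → transpose i j k ≡ k
  transpose-fixes {i} {j} {k} k≢i k≢j with k ≟ i
  ... | yes k≡i = contradiction k≡i k≢i
  ... | no _ with k ≟ j
  ...   | yes k≡j = contradiction k≡j k≢j
  ...   | no _    = refl

  transpose-injective : ∀ (i j : Fin n) → Injective _≡_ _≡_ (transpose i j)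
  transpose-injective i j {x} {y} eq = begin
    x                                 ≡⟨ transpose-inverse j i ⟨
    transpose j i (transpose i j x)   ≡⟨ cong (transpose j i) eq ⟩
    transpose j i (transpose i j y)   ≡⟨ transpose-inverse j i ⟩
    y                                 ∎
    where open ≡-Reasoning

module _ {k n : ℕ} {v : Fin k → Fin n} (v-injective : Injective _≡_ _≡_ v) where

  transpose-natural : ∀ i j r → transpose (v i) (v j) (v r) ≡ v (transpose i j r)
  transpose-natural i j r with r ≟ i
  ... | yes refl = transpose-fst (v r) (v j)
  ... | no r≢i with r ≟ j
  ...   | yes refl = transpose-snd (v i) (v r)
  ...   | no r≢j = transpose-fixes (r≢i ∘ v-injective) (r≢j ∘ v-injective)

module _ {n : ℕ} .{{_ : NonZero n}} where

  identityCopy : ℕ → Fin n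
  identityCopy i = i mod n

  identityCopy-isCopy : IsCopy n identityCopy
  identityCopy-isCopy u v u<n v<n eq = begin
    u                    ≡⟨ m<n⇒m%n≡m u<n ⟨
    u % n                ≡⟨ toℕ-fromℕ< _ ⟨
    toℕ (identityCopy u) ≡⟨ cong toℕ eq ⟩
    toℕ (identityCopy v) ≡⟨ toℕ-fromℕ< _ ⟩
    v % n                ≡⟨ m<n⇒m%n≡m v<n ⟩
    v                    ∎
    where open ≡-Reasoning

  transpose-isCopy : ∀ (x y : Fin n) {f} → IsCopy n f → IsCopy n (transpose x y ∘ f)
  transpose-isCopy x y f-copy u v u<n v<n = f-copy u v u<n v<n ∘ transpose-injective x y

  place : ∀ {k} → (Fin k → ℕ) → (Fin k → Fin n) → ℕ → Fin n
  place {zero}  P v = identityCopy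
  place {suc k} P v = transpose (g (P Fin.zero)) (v Fin.zero) ∘ g
    where
    g : ℕ → Fin n
    g = place (P ∘ Fin.suc) (v ∘ Fin.suc)

  place-isCopy : ∀ {k} (P : Fin k → ℕ) v → IsCopy n (place P v)
  place-isCopy {zero}  P v = identityCopy-isCopy
  place-isCopy {suc k} P v = transpose-isCopy _ _ (place-isCopy (P ∘ Fin.suc) (v ∘ Fin.suc))

  place-values : ∀ {k} {P : Fin k → ℕ} {v} → Injective _≡_ _≡_ P → (∀ i → P i < n) →
                 Injective _≡_ _≡_ v → ∀ i → place P v (P i) ≡ v i
  place-values {suc k} {P} {v} P-inj P<n v-inj Fin.zero =
    transpose-fst (place (P ∘ Fin.suc) (v ∘ Fin.suc) (P Fin.zero)) (v Fin.zero)
  place-values {suc k} {P} {v} P-inj P<n v-inj (Fin.suc i) = begin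
    transpose (g (P Fin.zero)) (v Fin.zero) (g (P (Fin.suc i))) ≡⟨ cong (transpose _ _) g-i ⟩
    transpose (g (P Fin.zero)) (v Fin.zero) (v (Fin.suc i))     ≡⟨ transpose-fixes ≢g₀ ≢v₀ ⟩
    v (Fin.suc i)                                               ∎
    where
    open ≡-Reasoning
    g : ℕ → Fin n
    g = place (P ∘ Fin.suc) (v ∘ Fin.suc)
    g-i : g (P (Fin.suc i)) ≡ v (Fin.suc i)
    g-i = place-values (suc-injective ∘ P-inj) (P<n ∘ Fin.suc) (suc-injective ∘ v-inj) i
    ≢g₀ : v (Fin.suc i) ≢ g (P Fin.zero)
    ≢g₀ eq with P-inj (place-isCopy (P ∘ Fin.suc) (v ∘ Fin.suc) _ _ (P<n _) (P<n _) (trans g-i eq))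
    ... | ()
    ≢v₀ : v (Fin.suc i) ≢ v Fin.zero
    ≢v₀ eq with v-inj eq
    ... | ()

-- The colouring

record Cherry {n : ℕ} (χ : Colouring n) (Out : Fin n → Set) : Set where
  field
    w p q         : Fin n
    w-out         : Out w
    p-out         : Out p
    q-out         : Out q
    w≢p           : w ≢ p
    w≢q           : w ≢ q
    wp≢wq         : col χ w p ≢ col χ w q

-- If the two edges are disjoint, compare uv with ux: either they differ, or ux has the
-- colour of uv and so differs from xy.
cherry : ∀ {n} (χ : Colouring n) {Out : Fin n → Set} {u v x y} → Out u → Out v → Out x → Out y →
         u ≢ v → x ≢ y → col χ u v ≢ col χ x y → Cherry χ Out
cherry χ {u = u} {v} {x} {y} ou ov ox oy u≢v x≢y uv≢xy with x ≟ u | x ≟ v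
... | yes refl | _ =
  record { w-out = ou ; p-out = ov ; q-out = oy ; w≢p = u≢v ; w≢q = x≢y ; wp≢wq = uv≢xy }
... | no _ | yes refl =
  record { w-out = ov ; p-out = ou ; q-out = oy ; w≢p = u≢v ∘ sym ; w≢q = x≢y
         ; wp≢wq = uv≢xy ∘ trans (symm χ u x) }
... | no x≢u | no x≢v with col χ u v ≟ col χ u x
...   | no uv≢ux =
  record { w-out = ou ; p-out = ov ; q-out = ox ; w≢p = u≢v ; w≢q = x≢u ∘ sym ; wp≢wq = uv≢ux }
...   | yes uv≡ux =
  record { w-out = ox ; p-out = ou ; q-out = oy ; w≢p = x≢u ; w≢q = x≢y
         ; wp≢wq = λ xu≡xy → uv≢xy (trans uv≡ux (trans (symm χ u x) xu≡xy)) }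

record Configuration {n : ℕ} (χ : Colouring n) : Set where
  field
    a b c d w p q : Fin n
    alternating   : Alternating χ a b c d
    w-out         : Outside a b c d w
    p-out         : Outside a b c d p
    q-out         : Outside a b c d q
    w≢p           : w ≢ p
    w≢q           : w ≢ q
    wp≢wq         : col χ w p ≢ col χ w q

configuration : ∀ {n} (χ : Colouring n) {a b c d} →
                Alternating χ a b c d → NotMonoOutside χ a b c d → Configuration χ
configuration χ {a} {b} {c} {d} alt (_ , _ , _ , _ , ou , ov , ox , oy , u≢v , x≢y , uv≢xy) =
  record { alternating = alt ; w-out = w-out ; p-out = p-out ; q-out = q-out
         ; w≢p = w≢p ; w≢q = w≢q ; wp≢wq = wp≢wq }
  where open Cherry (cherry χ {Outside a b c d} ou ov ox oy u≢v x≢y uv≢xy)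

module Roles {n : ℕ} {χ : Colouring n} (C : Configuration χ) where

  open Configuration C

  p≢q : p ≢ q
  p≢q p≡q = wp≢wq (cong (col χ w) p≡q)

  Fresh : Fin n → Set
  Fresh x = Outside a b c d x × x ≢ p × x ≢ q

  w-fresh : Fresh w
  w-fresh = w-out , w≢p , w≢q

  pattern Rx = 0F
  pattern Rp = 1F
  pattern Rq = 2F
  pattern Ra = 3F
  pattern Rb = 4F
  pattern Rc = 5F
  pattern Rd = 6F

  role : Fin n → Fin 7 → Fin n
  role x = lookup (x ∷ p ∷ q ∷ a ∷ b ∷ c ∷ d ∷ [])

  role-injective : ∀ {x} → Fresh x → Injective _≡_ _≡_ (role x)
  role-injective fresh with alternating | p-out | q-out | fresh
  ... | a≢b , a≢c , a≢d , b≢c , b≢d , c≢d , _ | p≢a , p≢b , p≢c , p≢d | q≢a , q≢b , q≢c , q≢d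
      | (x≢a , x≢b , x≢c , x≢d) , x≢p , x≢q = lookup-injective
    ( (x≢p ∷ x≢q ∷ x≢a ∷ x≢b ∷ x≢c ∷ x≢d ∷ [])
    ∷ (p≢q ∷ p≢a ∷ p≢b ∷ p≢c ∷ p≢d ∷ [])
    ∷ (q≢a ∷ q≢b ∷ q≢c ∷ q≢d ∷ [])
    ∷ (a≢b ∷ a≢c ∷ a≢d ∷ [])
    ∷ (b≢c ∷ b≢d ∷ [])
    ∷ (c≢d ∷ [])
    ∷ [] ∷ [] ) _ _

  pw≢qw : col χ p w ≢ col χ q w
  pw≢qw pw≡qw = wp≢wq (trans (symm χ w p) (trans pw≡qw (symm χ q w)))

  assign : Fin n → ∀ {k} → Vec (Fin 7) k → Fin k → Fin n
  assign x π = role x ∘ lookup π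

  assign-injective : ∀ {x k} (π : Vec (Fin 7) k) → Fresh x →
                     True (allPairs? (λ i j → ¬? (i ≟ j)) π) → Injective _≡_ _≡_ (assign x π)
  assign-injective π fresh distinct = lookup-injective-by-decision _≟_ π distinct ∘ role-injective fresh

  frame-unbalanced : Σ₃ (col χ a b ∷ col χ c d ∷ []) ≢ Σ₃ (col χ a d ∷ col χ c b ∷ [])
  frame-unbalanced balanced with alternating
  ... | _ , _ , _ , _ , _ , _ , ab+cd≢bc+da = ab+cd≢bc+da (begin
      (toℕ ab + toℕ cd) % 3  ≡⟨ toℕ-+₃ ab cd ⟨
      toℕ (ab +₃ cd)         ≡⟨ cong toℕ (trans (sym (Σ₃-pair ab cd)) (trans balanced (Σ₃-pair ad cb))) ⟩
      toℕ (ad +₃ cb)         ≡⟨ toℕ-+₃ ad cb ⟩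
      (toℕ ad + toℕ cb) % 3  ≡⟨ cong (_% 3) (cong₂ _+_ (cong toℕ (symm χ a d)) (cong toℕ (symm χ c b))) ⟩
      (toℕ da + toℕ bc) % 3  ≡⟨ cong (_% 3) (+-comm (toℕ da) (toℕ bc)) ⟩
      (toℕ bc + toℕ da) % 3  ∎)
    where
    open ≡-Reasoning
    ab cd ad cb bc da : ℤ₃
    ab = col χ a b; cd = col χ c d; ad = col χ a d; cb = col χ c b; bc = col χ b c; da = col χ d a

  frame-unbalanced′ : Σ₃ (col χ c d ∷ col χ a b ∷ []) ≢ Σ₃ (col χ c b ∷ col χ a d ∷ [])
  frame-unbalanced′ balanced =
    frame-unbalanced (trans (Σ₃-swap (col χ a b) (col χ c d))
                            (trans balanced (Σ₃-swap (col χ c b) (col χ a d))))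

  tilt : ℤ₃
  tilt = col χ a p -₃ col χ a q

  SameTilt : Fin n → Set
  SameTilt y = col χ y p ≡ col χ y q +₃ tilt

  tilt-nonzero : SameTilt w → tilt ≢ 0F
  tilt-nonzero w-tilted tilt≡0 =
    wp≢wq (trans w-tilted (trans (cong (col χ w q +₃_) tilt≡0) (+₃-identityʳ (col χ w q))))

  starWeight : Fin n → ∀ {l} → (Fin l → Fin n) → ℤ₃
  starWeight x ys = Σ₃ (tabulate λ j → col χ x (ys j))

  star-tilt : ∀ {l} (ys : Fin l → Fin n) → (∀ j → SameTilt (ys j)) →
              starWeight p ys ≡ starWeight q ys +₃ l · tilt
  star-tilt ys tilted = Σ₃-tabulate-shift _ _ tilt λ j →
    trans (symm χ p (ys j)) (trans (tilted j) (cong (_+₃ tilt) (symm χ (ys j) q)))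

  anchor-tilt : col χ a p ≡ col χ a q +₃ tilt
  anchor-tilt = +₃-difference (col χ a p) (col χ a q)

  anchor-tilt′ : col χ p a ≡ col χ q a +₃ tilt
  anchor-tilt′ = trans (symm χ p a) (trans anchor-tilt (cong (_+₃ tilt) (symm χ a q)))

  module _ {l} (ys : Fin l → Fin n) (tilted : ∀ j → SameTilt (ys j)) where

    star-shift₂ : Σ₃ (col χ p q ∷ starWeight p ys ∷ [])
                    ≡ Σ₃ (col χ q p ∷ starWeight q ys ∷ []) +₃ l · tilt
    star-shift₂ = begin
      Σ₃ (col χ p q ∷ starWeight p ys ∷ [])
        ≡⟨ cong (λ T → Σ₃ (col χ p q ∷ T ∷ [])) (star-tilt ys tilted) ⟩
      Σ₃ (col χ p q ∷ (starWeight q ys +₃ l · tilt) ∷ [])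
        ≡⟨ Σ₃-shift₂ (col χ p q) (starWeight q ys) (l · tilt) ⟩
      Σ₃ (col χ p q ∷ starWeight q ys ∷ []) +₃ l · tilt
        ≡⟨ cong (λ u → Σ₃ (u ∷ starWeight q ys ∷ []) +₃ l · tilt) (symm χ p q) ⟩
      Σ₃ (col χ q p ∷ starWeight q ys ∷ []) +₃ l · tilt  ∎
      where open ≡-Reasoning

    star-shift₃ : ∀ {x x′} → x ≡ x′ +₃ tilt →
                  Σ₃ (x ∷ col χ p q ∷ starWeight p ys ∷ [])
                    ≡ Σ₃ (x′ ∷ col χ q p ∷ starWeight q ys ∷ []) +₃ suc l · tilt
    star-shift₃ {x} {x′} x≡x′+tilt = begin
      Σ₃ (x ∷ col χ p q ∷ starWeight p ys ∷ [])
        ≡⟨ cong₂ (λ u T → Σ₃ (u ∷ col χ p q ∷ T ∷ [])) x≡x′+tilt (star-tilt ys tilted) ⟩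
      Σ₃ ((x′ +₃ tilt) ∷ col χ p q ∷ (starWeight q ys +₃ l · tilt) ∷ [])
        ≡⟨ Σ₃-shift₃ x′ (col χ p q) (starWeight q ys) tilt (l · tilt) ⟩
      Σ₃ (x′ ∷ col χ p q ∷ starWeight q ys ∷ []) +₃ suc l · tilt
        ≡⟨ cong (λ u → Σ₃ (x′ ∷ u ∷ starWeight q ys ∷ []) +₃ suc l · tilt) (symm χ p q) ⟩
      Σ₃ (x′ ∷ col χ q p ∷ starWeight q ys ∷ []) +₃ suc l · tilt  ∎
      where open ≡-Reasoning

-- The forest F

module Forest (d₁ m d₂ d₃ : ℕ) where

  blockSize : ℕ → ℕ
  blockSize 0 = 2 + m
  blockSize 1 = d₁
  blockSize 2 = d₂
  blockSize 3 = 1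
  blockSize _ = d₃

  -- Vertex i of block b is vertex offset b + i of F: the spine p₁ = 0, …, p₂ = m + 1, the leaves
  -- of p₁, the leaves of p₂, the star centre and its leaves, numbered as in Fedges.
  Node : Set
  Node = Σ[ b ∈ Fin 5 ] Fin (blockSize (toℕ b))

  _≟ₙ_ : DecidableEquality Node
  _≟ₙ_ = ≡-dec _≟_ _≟_

  spine : Fin (2 + m) → Node
  spine i = 0F , i

  leaf₁ : Fin d₁ → Node
  leaf₁ j = 1F , j

  leaf₂ : Fin d₂ → Node
  leaf₂ j = 2F , j

  hub : Node
  hub = 3F , 0F

  leaf₃ : Fin d₃ → Node
  leaf₃ j = 4F , j

  p₁ p₂ : Node
  p₁ = spine Fin.zero
  p₂ = spine (fromℕ (suc m))

  offset : ℕ → ℕ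
  offset zero    = 0
  offset (suc b) = offset b + blockSize b

  index : Node → ℕ
  index (b , i) = offset (toℕ b) + toℕ i

  offset-mono : ∀ {b b'} → b ≤ b' → offset b ≤ offset b'
  offset-mono {b' = zero} z≤n = ≤-refl
  offset-mono {b' = suc b'} b≤1+b' with m≤n⇒m<n∨m≡n b≤1+b'
  ... | inj₂ refl = ≤-refl
  ... | inj₁ (s≤s b≤b') = ≤-trans (offset-mono b≤b') (m≤m+n _ _)

  index<offset : ∀ x → index x < offset (suc (toℕ (proj₁ x)))
  index<offset (b , i) = +-monoʳ-< (offset (toℕ b)) (toℕ<n i)

  index-injective : ∀ {x y} → index x ≡ index y → x ≡ y
  index-injective {b , i} {c , j} eq with <-cmp (toℕ b) (toℕ c)
  ... | tri< b<c _ _ = contradiction eq (<⇒≢ (<-≤-trans (index<offset (b , i))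
                         (≤-trans (offset-mono b<c) (m≤m+n _ (toℕ j)))))
  ... | tri> _ _ c<b = contradiction (sym eq) (<⇒≢ (<-≤-trans (index<offset (c , j))
                         (≤-trans (offset-mono c<b) (m≤m+n _ (toℕ i)))))
  ... | tri≈ _ b≡c _ with toℕ-injective b≡c
  ...   | refl = cong (b ,_) (toℕ-injective (+-cancelˡ-≡ (offset (toℕ b)) _ _ eq))

  index<Fsize : ∀ x → index x < Fsize d₁ m d₂ d₃
  index<Fsize (b , i) = <-≤-trans (index<offset (b , i))
    (≤-trans (offset-mono (toℕ<n b)) (≤-reflexive (size-eq d₁ m d₂ d₃)))
    where
    size-eq : ∀ d₁ m d₂ d₃ → (((2 + m) + d₁) + d₂) + 1 + d₃ ≡ d₁ + d₂ + d₃ + m + 3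
    size-eq = solve-∀

  starEdges : Node → ∀ {k} → (Fin k → Node) → List (Node × Node)
  starEdges centre leaf = tabulate (λ j → (centre , leaf j))

  edges : List (Node × Node)
  edges = tabulate (λ (i : Fin (suc m)) → (spine (inject₁ i) , spine (Fin.suc i)))
       ++ starEdges p₁ leaf₁ ++ starEdges p₂ leaf₂ ++ starEdges hub leaf₃

  index² : Node × Node → ℕ × ℕ
  index² (x , y) = (index x , index y)

  private
    block-indices : ∀ {k} (g : ℕ → ℕ × ℕ) (h : Fin k → Node × Node) →
                    (∀ j → g (toℕ j) ≡ index² (h j)) → map g (upTo k) ≡ map index² (tabulate h)
    block-indices {k} g h g≡h = begin
      map g (upTo k)           ≡⟨ map-upTo g k ⟩
      applyUpTo g k            ≡⟨ applyUpTo-tabulate g k ⟩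
      tabulate (g ∘ toℕ)       ≡⟨ tabulate-cong g≡h ⟩
      tabulate (index² ∘ h)    ≡⟨ map-tabulate h index² ⟨
      map index² (tabulate h)  ∎
      where open ≡-Reasoning

    offset₁ : offset 1 ≡ m + 2
    offset₁ = +-comm 2 m

  Fedges-edges : Fedges d₁ m d₂ d₃ ≡ map index² edges
  Fedges-edges = begin
    Fedges d₁ m d₂ d₃
      ≡⟨ cong₂ _++_ path (cong₂ _++_ (block-indices _ (λ j → (p₁ , leaf₁ j)) star₁)
                         (cong₂ _++_ (block-indices _ (λ j → (p₂ , leaf₂ j)) star₂)
                                     (block-indices _ (λ j → (hub , leaf₃ j)) star₃))) ⟩
    map index² P ++ map index² S₁ ++ map index² S₂ ++ map index² S₃
      ≡⟨ cong (λ xs → map index² P ++ map index² S₁ ++ xs) (map-++ index² S₂ S₃) ⟨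
    map index² P ++ map index² S₁ ++ map index² (S₂ ++ S₃)
      ≡⟨ cong (map index² P ++_) (map-++ index² S₁ (S₂ ++ S₃)) ⟨
    map index² P ++ map index² (S₁ ++ S₂ ++ S₃)
      ≡⟨ map-++ index² P (S₁ ++ S₂ ++ S₃) ⟨
    map index² edges ∎
    where
    open ≡-Reasoning
    P S₁ S₂ S₃ : List (Node × Node)
    P  = tabulate (λ (i : Fin (suc m)) → (spine (inject₁ i) , spine (Fin.suc i)))
    S₁ = starEdges p₁ leaf₁
    S₂ = starEdges p₂ leaf₂
    S₃ = starEdges hub leaf₃
    path : map (λ i → (i , suc i)) (upTo (suc m)) ≡ map index² P
    path = block-indices (λ i → (i , suc i)) (λ i → (spine (inject₁ i) , spine (Fin.suc i)))
             λ i → cong (_, suc (toℕ i)) (sym (toℕ-inject₁ i))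
    star₁ : ∀ j → (0 , m + 2 + toℕ j) ≡ index² (p₁ , leaf₁ j)
    star₁ j = cong (λ o → (0 , o + toℕ j)) (sym offset₁)
    star₂ : ∀ j → (suc m , m + 2 + d₁ + toℕ j) ≡ index² (p₂ , leaf₂ j)
    star₂ j = cong₂ _,_ (sym (toℕ-fromℕ (suc m))) (cong (λ o → o + d₁ + toℕ j) (sym offset₁))
    star₃ : ∀ j → (m + 2 + d₁ + d₂ , m + 2 + d₁ + d₂ + 1 + toℕ j) ≡ index² (hub , leaf₃ j)
    star₃ j = cong₂ _,_ (trans (cong (λ o → o + d₁ + d₂) (sym offset₁)) (sym (+-identityʳ _)))
                        (cong (λ o → o + d₁ + d₂ + 1 + toℕ j) (sym offset₁))

  data Block (k : ℕ) : Set where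
    edge : Fin k → Fin k → Block k
    star : Fin k → ∀ {l} → (Fin l → Node) → Block k

  module _ {k} (node : Fin k → Node) where

    blockEdges : Block k → List (Node × Node)
    blockEdges (edge i j) = (node i , node j) ∷ []
    blockEdges (star i g) = starEdges (node i) g

    -- The last block is not followed by `++ []`, so that shapes can cover `edges` by refl.
    flatten : List (Block k) → List (Node × Node)
    flatten []            = []
    flatten (b ∷ [])      = blockEdges b
    flatten (b ∷ b' ∷ bs) = blockEdges b ++ flatten (b' ∷ bs)

    Far : Block k → Set
    Far (edge _ _) = ⊤
    Far (star _ g) = ∀ j r → g j ≢ node r

  far-by-decision : ∀ {k} {node : Fin k → Node} {l} (g : Fin l → Node) →
                    (∀ j → True (all? λ s → ¬? (g j ≟ₙ node s))) → ∀ j s → g j ≢ node s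
  far-by-decision g decided j = toWitness (decided j)

  At : ∀ {k} → Fin k → Fin k → Fin k → Set
  At i j r = r ≡ i ⊎ r ≡ j

  Touches : ∀ {k} → Fin k → Fin k → Block k → Set
  Touches i j (edge r s) = At i j r ⊎ At i j s
  Touches i j (star r g) = At i j r

  touches? : ∀ {k} (i j : Fin k) → Decidable (Touches i j)
  touches? i j (edge r s) = ((r ≟ i) ⊎-dec (r ≟ j)) ⊎-dec ((s ≟ i) ⊎-dec (s ≟ j))
  touches? i j (star r g) = (r ≟ i) ⊎-dec (r ≟ j)

  -- A shape names k vertices of F and lists the edges of F, in the order of `edges`, as edges
  -- between named vertices and stars from a named vertex to unnamed leaves.
  record Shape : Set where
    field
      k              : ℕ
      node           : Fin k → Node
      blocks         : List (Block k)
      node-injective : Injective _≡_ _≡_ node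
      far            : All (Far node) blocks
      covers         : edges ≡ flatten node blocks

-- Weights of copies

module Copies (d₁ m d₂ d₃ : ℕ) (χ : Colouring (Fsize d₁ m d₂ d₃)) where

  open Forest d₁ m d₂ d₃

  private
    n : ℕ
    n = Fsize d₁ m d₂ d₃

    instance
      n-nonZero : NonZero n
      n-nonZero = ℕ.>-nonZero (≤-trans (s≤s z≤n) (m≤n+m 3 (d₁ + d₂ + d₃ + m)))

  ZeroSumCopy : Set
  ZeroSumCopy = ∃[ f ] (IsCopy n f × copyColourSum χ f (Fedges d₁ m d₂ d₃) % 3 ≡ 0)

  weight : (ℕ → Fin n) → ℤ₃
  weight f = [ copyColourSum χ f (Fedges d₁ m d₂ d₃) ]₃

  zero-weight : ∀ {f} → IsCopy n f → weight f ≡ 0F → ZeroSumCopy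
  zero-weight {f} f-copy w≡0 =
    f , f-copy , trans (sym (toℕ-[]₃ (copyColourSum χ f (Fedges d₁ m d₂ d₃)))) (cong toℕ w≡0)

  zero-sum-from-copies : ∀ {f₁ f₁′ f₂ f₂′} →
                         IsCopy n f₁ → IsCopy n f₁′ → IsCopy n f₂ → IsCopy n f₂′ → ∀ {x y} → x ≢ y →
                         weight f₁′ +₃ x ≡ weight f₁ +₃ y → weight f₂′ +₃ x ≡ weight f₂ +₃ y →
                         weight f₁ ≢ weight f₂ → ZeroSumCopy
  zero-sum-from-copies c₁ c₁′ c₂ c₂′ x≢y e₁ e₂ w₁≢w₂
    with two-shifts _ _ _ _ _ _ x≢y w₁≢w₂ e₁ e₂
  ... | inj₁ z               = zero-weight c₁ z
  ... | inj₂ (inj₁ z)        = zero-weight c₁′ z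
  ... | inj₂ (inj₂ (inj₁ z)) = zero-weight c₂ z
  ... | inj₂ (inj₂ (inj₂ z)) = zero-weight c₂′ z

  _⟨_⟩ : (ℕ → Fin n) → Node → Fin n
  f ⟨ x ⟩ = f (index x)

  colours : (ℕ → Fin n) → List (Node × Node) → List ℤ₃
  colours f = map λ (x , y) → col χ (f ⟨ x ⟩) (f ⟨ y ⟩)

  weight-edges : ∀ f → weight f ≡ Σ₃ (colours f edges)
  weight-edges f = begin
    [ sum (map (toℕ ∘ colour) (Fedges d₁ m d₂ d₃)) ]₃
      ≡⟨ cong (λ es → [ sum (map (toℕ ∘ colour) es) ]₃) Fedges-edges ⟩
    [ sum (map (toℕ ∘ colour) (map index² edges)) ]₃
      ≡⟨ cong (λ cs → [ sum cs ]₃) (trans (sym (map-∘ {g = toℕ ∘ colour} {f = index²} edges))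
                                         (map-∘ {g = toℕ} {f = colour ∘ index²} edges)) ⟩
    [ sum (map toℕ (colours f edges)) ]₃
      ≡⟨ [sum]₃ (colours f edges) ⟩
    Σ₃ (colours f edges)  ∎
    where
    open ≡-Reasoning
    colour : ℕ × ℕ → ℤ₃
    colour (u , v) = col χ (f u) (f v)

  record Layout {k} (node : Fin k → Node) (v : Fin k → Fin n) : Set where
    field
      copy   : ℕ → Fin n
      isCopy : IsCopy n copy
      values : ∀ i → copy ⟨ node i ⟩ ≡ v i

  module _ {k} {node : Fin k → Node} (node-injective : Injective _≡_ _≡_ node) where

    abstract
      layout : ∀ {v} → Injective _≡_ _≡_ v → Layout node v
      layout {v} v-injective = record
        { copy   = place (index ∘ node) v
        ; isCopy = place-isCopy (index ∘ node) v
        ; values = place-values (node-injective ∘ index-injective) (index<Fsize ∘ node) v-injective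
        }

    layout-injective : ∀ {v} → Layout node v → Injective _≡_ _≡_ v
    layout-injective {v} L {i} {j} vi≡vj =
      node-injective (index-injective (isCopy _ _ (index<Fsize (node i)) (index<Fsize (node j))
        (trans (values i) (trans vi≡vj (sym (values j))))))
      where open Layout L

  leaf-away : ∀ {k} {node : Fin k → Node} {v} (L : Layout node v) {l} {g : Fin l → Node} →
              (∀ j s → g j ≢ node s) → ∀ j s → Layout.copy L ⟨ g j ⟩ ≢ v s
  leaf-away {node = node} L {g = g} g-far j s gj≡vs =
    g-far j s (index-injective (isCopy _ _ (index<Fsize (g j)) (index<Fsize (node s))
                                          (trans gj≡vs (sym (values s)))))
    where open Layout L

  extend : ∀ {k} {node : Fin (suc k) → Node} {v} (L : Layout (node ∘ Fin.suc) v) →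
           Layout node (Layout.copy L ⟨ node Fin.zero ⟩ ∷ᵛ v)
  extend L = record
    { copy = copy ; isCopy = isCopy ; values = λ { Fin.zero → refl ; (Fin.suc i) → values i } }
    where open Layout L

  blockWeight : ∀ {k} → (Fin k → Fin n) → (ℕ → Fin n) → Block k → ℤ₃
  blockWeight v f (edge i j) = col χ (v i) (v j)
  blockWeight v f (star i g) = Σ₃ (tabulate λ j → col χ (v i) (f ⟨ g j ⟩))

  module _ {k} (node : Fin k → Node) (f : ℕ → Fin n) where

    private
      at : Fin k → Fin n
      at i = f ⟨ node i ⟩

    Σ₃-blockEdges : ∀ b → Σ₃ (colours f (blockEdges node b)) ≡ blockWeight at f b
    Σ₃-blockEdges (edge i j) = +₃-identityʳ _
    Σ₃-blockEdges (star i g) = cong Σ₃ (map-tabulate (λ j → (node i , g j)) _)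

    Σ₃-flatten : ∀ bs → Σ₃ (colours f (flatten node bs)) ≡ Σ₃ (map (blockWeight at f) bs)
    Σ₃-flatten []            = refl
    Σ₃-flatten (b ∷ [])      = trans (Σ₃-blockEdges b) (sym (+₃-identityʳ _))
    Σ₃-flatten (b ∷ b' ∷ bs) = begin
      Σ₃ (colours f (blockEdges node b ++ flatten node (b' ∷ bs)))
        ≡⟨ cong Σ₃ (map-++ _ (blockEdges node b) (flatten node (b' ∷ bs))) ⟩
      Σ₃ (colours f (blockEdges node b) ++ colours f (flatten node (b' ∷ bs)))
        ≡⟨ Σ₃-++ (colours f (blockEdges node b)) _ ⟩
      Σ₃ (colours f (blockEdges node b)) +₃ Σ₃ (colours f (flatten node (b' ∷ bs)))
        ≡⟨ cong₂ _+₃_ (Σ₃-blockEdges b) (Σ₃-flatten (b' ∷ bs)) ⟩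
      blockWeight at f b +₃ Σ₃ (map (blockWeight at f) (b' ∷ bs))  ∎
      where open ≡-Reasoning

  module Swaps (sh : Shape) where

    open Shape sh

    localWeight : (Fin k → Fin n) → (ℕ → Fin n) → Fin k → Fin k → ℤ₃
    localWeight v f i j = Σ₃ (map (blockWeight v f) (filter (touches? i j) blocks))

    weight-blocks : ∀ f → weight f ≡ Σ₃ (map (blockWeight (λ i → f ⟨ node i ⟩) f) blocks)
    weight-blocks f =
      trans (weight-edges f) (trans (cong (Σ₃ ∘ colours f) covers) (Σ₃-flatten node f blocks))

    swapped : ∀ {v} → Layout node v → ∀ i j → Layout node (v ∘ transpose i j)
    swapped {v} L i j = record
      { copy   = transpose (v i) (v j) ∘ copy
      ; isCopy = transpose-isCopy (v i) (v j) isCopy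
      ; values = λ r → trans (cong (transpose (v i) (v j)) (values r))
                             (transpose-natural (layout-injective node-injective L) i j r)
      }
      where open Layout L

    swap-formula : ∀ {v} (L : Layout node v) i j →
      let open Layout L in
      weight (Layout.copy (swapped L i j)) +₃ localWeight v copy i j
        ≡ weight copy +₃ localWeight (v ∘ transpose i j) copy i j
    swap-formula {v} L i j = begin
      weight f′ +₃ localWeight v f i j
        ≡⟨ cong (_+₃ localWeight v f i j)
                (trans (weight-blocks f′) (cong Σ₃ (map-cong-local (All.map moved far)))) ⟩
      Σ₃ (map (blockWeight (v ∘ τ) f) blocks) +₃ localWeight v f i j
        ≡⟨ Σ₃-filter-exchange (touches? i j) (blockWeight v f) (blockWeight (v ∘ τ) f) unmoved blocks ⟩
      Σ₃ (map (blockWeight v f) blocks) +₃ localWeight (v ∘ τ) f i j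
        ≡⟨ cong (_+₃ localWeight (v ∘ τ) f i j)
                (trans (weight-blocks f) (cong Σ₃ (map-cong-local (All.map placed far)))) ⟨
      weight f +₃ localWeight (v ∘ τ) f i j  ∎
      where
      open ≡-Reasoning
      open Layout L renaming (copy to f)
      τ : Fin k → Fin k
      τ = transpose i j
      f′ : ℕ → Fin n
      f′ = Layout.copy (swapped L i j)
      moved : ∀ {b} → Far node b → blockWeight (λ r → f′ ⟨ node r ⟩) f′ b ≡ blockWeight (v ∘ τ) f b
      moved {edge r s} _ = cong₂ (col χ) (Layout.values (swapped L i j) r) (Layout.values (swapped L i j) s)
      moved {star r g} g-far = cong Σ₃ (tabulate-cong λ l →
        cong₂ (col χ) (Layout.values (swapped L i j) r)
                      (transpose-fixes (leaf-away L g-far l i) (leaf-away L g-far l j)))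
      placed : ∀ {b} → Far node b → blockWeight (λ r → f ⟨ node r ⟩) f b ≡ blockWeight v f b
      placed {edge r s} _ = cong₂ (col χ) (values r) (values s)
      placed {star r g} _ = cong Σ₃ (tabulate-cong λ l → cong (λ x → col χ x (f ⟨ g l ⟩)) (values r))
      fixed : ∀ {r} → ¬ At i j r → v (τ r) ≡ v r
      fixed r∉ = cong v (transpose-fixes (r∉ ∘ inj₁) (r∉ ∘ inj₂))
      unmoved : ∀ b → ¬ Touches i j b → blockWeight v f b ≡ blockWeight (v ∘ τ) f b
      unmoved (edge r s) ¬t = sym (cong₂ (col χ) (fixed (¬t ∘ inj₁)) (fixed (¬t ∘ inj₂)))
      unmoved (star r g) ¬t =
        sym (cong Σ₃ (tabulate-cong λ l → cong (λ x → col χ x (f ⟨ g l ⟩)) (fixed ¬t)))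

    zero-sum-from-layouts : ∀ {v₁ v₂} (L₁ : Layout node v₁) (L₂ : Layout node v₂) b d →
      let f₁ = Layout.copy L₁; f₂ = Layout.copy L₂ in
      localWeight v₁ f₁ b d ≢ localWeight (v₁ ∘ transpose b d) f₁ b d →
      localWeight v₂ f₂ b d ≡ localWeight v₁ f₁ b d →
      localWeight (v₂ ∘ transpose b d) f₂ b d ≡ localWeight (v₁ ∘ transpose b d) f₁ b d →
      weight f₁ ≢ weight f₂ → ZeroSumCopy
    zero-sum-from-layouts L₁ L₂ b d unbalanced same-before same-after =
      zero-sum-from-copies (Layout.isCopy L₁) (Layout.isCopy (swapped L₁ b d))
                 (Layout.isCopy L₂) (Layout.isCopy (swapped L₂ b d))
                 unbalanced (swap-formula L₁ b d)
                 (subst₂ (λ x y → weight (Layout.copy (swapped L₂ b d)) +₃ x ≡ weight (Layout.copy L₂) +₃ y)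
                         same-before same-after (swap-formula L₂ b d))

    swap-changes-weight : ∀ {v} (L : Layout node v) i j →
      let f = Layout.copy L in
      localWeight v f i j ≢ localWeight (v ∘ transpose i j) f i j →
      weight f ≢ weight (Layout.copy (swapped L i j))
    swap-changes-weight L i j = shifts-differ _ _ _ _ (swap-formula L i j)

    balanced-or-zero-sum : ∀ {v} (L : Layout node v) b d i j →
      let f = Layout.copy L; f′ = Layout.copy (swapped L i j) in
      localWeight v f b d ≢ localWeight (v ∘ transpose b d) f b d →
      localWeight (v ∘ transpose i j) f′ b d ≡ localWeight v f b d →
      localWeight (v ∘ transpose i j ∘ transpose b d) f′ b d ≡ localWeight (v ∘ transpose b d) f b d →
      ZeroSumCopy ⊎ localWeight v f i j ≡ localWeight (v ∘ transpose i j) f i j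
    balanced-or-zero-sum {v} L b d i j unbalanced same-before same-after
      with localWeight v (Layout.copy L) i j ≟ localWeight (v ∘ transpose i j) (Layout.copy L) i j
    ... | yes balanced   = inj₂ balanced
    ... | no unbalanced′ =
      inj₁ (zero-sum-from-layouts L (swapped L i j) b d unbalanced same-before same-after
                                  (swap-changes-weight L i j unbalanced′))

-- Spines with an internal vertex

module Spine₄ (k₁ k₂ k₃ : ℕ) (χ : Colouring (Fsize (suc k₁) 2 (suc k₂) (suc k₃)))
              (C : Configuration χ) where

  open Forest (suc k₁) 2 (suc k₂) (suc k₃)
  open Copies (suc k₁) 2 (suc k₂) (suc k₃) χ
  open Configuration C
  open Roles C

  shape : Shape
  shape = record
    { k              = 8
    ; node           = lookup nodes
    ; blocks         = edge 0F 1F ∷ edge 1F 2F ∷ edge 2F 3F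
                     ∷ edge 0F 4F ∷ star 0F (leaf₁ ∘ Fin.suc)
                     ∷ edge 3F 5F ∷ star 3F (leaf₂ ∘ Fin.suc)
                     ∷ edge 6F 7F ∷ star 6F (leaf₃ ∘ Fin.suc) ∷ []
    ; node-injective = lookup-injective-by-decision _≟ₙ_ nodes _
    ; far            = _ ∷ _ ∷ _ ∷ _ ∷ far-by-decision _ (λ _ → _)
                     ∷ _ ∷ far-by-decision _ (λ _ → _)
                     ∷ _ ∷ far-by-decision _ (λ _ → _) ∷ []
    ; covers         = refl
    }
    where
    nodes : Vec Node 8
    nodes = spine 0F ∷ spine 1F ∷ spine 2F ∷ spine 3F ∷ leaf₁ 0F ∷ leaf₂ 0F ∷ hub ∷ leaf₃ 0F ∷ []

  open Shape shape using (node; node-injective)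
  open Swaps shape

  -- p sits on the spine between z = p₁ and w, and q is a leaf of z, so exchanging p and q shifts
  -- the weight by col(q,w) − col(p,w); b and d are leaves of a = p₂ and of c = the star centre.
  zero-sum : ZeroSumCopy
  zero-sum = zero-sum-from-layouts L (swapped L 1F 4F) 5F 7F frame-unbalanced refl refl
               (swap-changes-weight L 1F 4F
                 (one-term-differs₃ (col χ p w) (col χ q w) (col χ z p) (col χ z q) pw≢qw))
    where
    π : Vec (Fin 7) 7
    π = Rp ∷ Rx ∷ Ra ∷ Rq ∷ Rb ∷ Rc ∷ Rd ∷ []
    L₇ : Layout (node ∘ Fin.suc) (assign w π)
    L₇ = layout (suc-injective ∘ node-injective) (assign-injective π w-fresh _)
    z : Fin (Fsize (suc k₁) 2 (suc k₂) (suc k₃))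
    z = Layout.copy L₇ ⟨ node 0F ⟩
    L : Layout node (z ∷ᵛ assign w π)
    L = extend L₇

module Spine₃ (k₁ d₂ k₃ : ℕ) (χ : Colouring (Fsize (2 + k₁) 1 d₂ (suc k₃)))
              (C : Configuration χ) where

  open Forest (2 + k₁) 1 d₂ (suc k₃)
  open Copies (2 + k₁) 1 d₂ (suc k₃) χ
  open Configuration C
  open Roles C

  shape : Shape
  shape = record
    { k              = 7
    ; node           = lookup nodes
    ; blocks         = edge 0F 1F ∷ edge 1F 2F
                     ∷ edge 0F 3F ∷ edge 0F 4F ∷ star 0F (leaf₁ ∘ Fin.suc ∘ Fin.suc)
                     ∷ star 2F leaf₂
                     ∷ edge 5F 6F ∷ star 5F (leaf₃ ∘ Fin.suc) ∷ []
    ; node-injective = lookup-injective-by-decision _≟ₙ_ nodes _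
    ; far            = _ ∷ _ ∷ _ ∷ _ ∷ far-by-decision _ (λ _ → _) ∷ far-by-decision _ (λ _ → _)
                     ∷ _ ∷ far-by-decision _ (λ _ → _) ∷ []
    ; covers         = refl
    }
    where
    nodes : Vec Node 7
    nodes = spine 0F ∷ spine 1F ∷ spine 2F ∷ leaf₁ 0F ∷ leaf₁ 1F ∷ hub ∷ leaf₃ 0F ∷ []

  open Shape shape using (node; node-injective)
  open Swaps shape

  -- a = p₁ has the leaves q and b, p is the middle of the spine and w = p₂, so exchanging p and q
  -- shifts the weight by col(q,w) − col(p,w); d is a leaf of c = the star centre.
  zero-sum : ZeroSumCopy
  zero-sum = zero-sum-from-layouts L (swapped L 1F 3F) 4F 6F frame-unbalanced refl refl
               (swap-changes-weight L 1F 3F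
                 (one-term-differs₃ (col χ p w) (col χ q w) (col χ a p) (col χ a q) pw≢qw))
    where
    π : Vec (Fin 7) 7
    π = Ra ∷ Rp ∷ Rx ∷ Rq ∷ Rb ∷ Rc ∷ Rd ∷ []
    L : Layout node (assign w π)
    L = layout node-injective (assign-injective π w-fresh _)

module Spine₃′ (k₂ k₃ : ℕ) (χ : Colouring (Fsize 1 1 (suc k₂) (suc k₃)))
               (C : Configuration χ) where

  open Forest 1 1 (suc k₂) (suc k₃)
  open Copies 1 1 (suc k₂) (suc k₃) χ
  open Configuration C
  open Roles C

  shape : Shape
  shape = record
    { k              = 7
    ; node           = lookup nodes
    ; blocks         = edge 0F 1F ∷ edge 1F 2F
                     ∷ edge 0F 3F
                     ∷ edge 2F 4F ∷ star 2F (leaf₂ ∘ Fin.suc)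
                     ∷ edge 5F 6F ∷ star 5F (leaf₃ ∘ Fin.suc) ∷ []
    ; node-injective = lookup-injective-by-decision _≟ₙ_ nodes _
    ; far            = _ ∷ _ ∷ _ ∷ _ ∷ far-by-decision _ (λ _ → _)
                     ∷ _ ∷ far-by-decision _ (λ _ → _) ∷ []
    ; covers         = refl
    }
    where
    nodes : Vec Node 7
    nodes = spine 0F ∷ spine 1F ∷ spine 2F ∷ leaf₁ 0F ∷ leaf₂ 0F ∷ hub ∷ leaf₃ 0F ∷ []

  open Shape shape using (node; node-injective)
  open Swaps shape

  -- p = p₁ has the single leaf q and w is the middle of the spine, so exchanging p and q shifts
  -- the weight by col(q,w) − col(p,w); b and d are leaves of a = p₂ and of c = the star centre.
  zero-sum : ZeroSumCopy
  zero-sum = zero-sum-from-layouts L (swapped L 0F 3F) 4F 6F frame-unbalanced refl refl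
               (swap-changes-weight L 0F 3F perturbed)
    where
    π : Vec (Fin 7) 7
    π = Rp ∷ Rx ∷ Ra ∷ Rq ∷ Rb ∷ Rc ∷ Rd ∷ []
    L : Layout node (assign w π)
    L = layout node-injective (assign-injective π w-fresh _)
    perturbed : Σ₃ (col χ p w ∷ col χ p q ∷ []) ≢ Σ₃ (col χ q w ∷ col χ q p ∷ [])
    perturbed balanced = one-term-differs₂ (col χ p w) (col χ q w) (col χ p q) pw≢qw
      (trans balanced (cong (λ x → Σ₃ (col χ q w ∷ x ∷ [])) (symm χ q p)))

-- Spines without an internal vertex

module Spine₂ (k₁ k₂ k₃ : ℕ) (χ : Colouring (Fsize (suc k₁) 0 (suc k₂) (suc k₃)))
              (C : Configuration χ) where

  open Forest (suc k₁) 0 (suc k₂) (suc k₃)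
  open Copies (suc k₁) 0 (suc k₂) (suc k₃) χ
  open Configuration C
  open Roles C

  shape : Shape
  shape = record
    { k              = 6
    ; node           = lookup nodes
    ; blocks         = edge 0F 2F
                     ∷ edge 0F 1F ∷ star 0F (leaf₁ ∘ Fin.suc)
                     ∷ edge 2F 3F ∷ star 2F (leaf₂ ∘ Fin.suc)
                     ∷ edge 4F 5F ∷ star 4F (leaf₃ ∘ Fin.suc) ∷ []
    ; node-injective = lookup-injective-by-decision _≟ₙ_ nodes _
    ; far            = _ ∷ _ ∷ far-by-decision _ (λ _ → _) ∷ _ ∷ far-by-decision _ (λ _ → _)
                     ∷ _ ∷ far-by-decision _ (λ _ → _) ∷ []
    ; covers         = refl
    }
    where
    nodes : Vec Node 6
    nodes = spine 0F ∷ leaf₁ 0F ∷ spine 1F ∷ leaf₂ 0F ∷ hub ∷ leaf₃ 0F ∷ []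

  open Shape shape using (node; node-injective)
  open Swaps shape

  TiltOrZeroSum : Set
  TiltOrZeroSum = ∀ y → Fresh y → ZeroSumCopy ⊎ SameTilt y

  residues : [ suc k₁ + suc k₂ + suc k₃ + 0 + 1 ]₃
             ≡ [ suc k₁ ]₃ +₃ [ suc k₂ ]₃ +₃ (1F +₃ [ k₃ ]₃) +₃ 0F +₃ 1F
  residues = begin
    [ suc k₁ + suc k₂ + suc k₃ + 0 + 1 ]₃
      ≡⟨ []₃-+ (suc k₁ + suc k₂ + suc k₃ + 0) 1 ⟩
    [ suc k₁ + suc k₂ + suc k₃ + 0 ]₃ +₃ 1F
      ≡⟨ cong (_+₃ 1F) ([]₃-+ (suc k₁ + suc k₂ + suc k₃) 0) ⟩
    [ suc k₁ + suc k₂ + suc k₃ ]₃ +₃ 0F +₃ 1F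
      ≡⟨ cong (λ x → x +₃ 0F +₃ 1F) ([]₃-+ (suc k₁ + suc k₂) (suc k₃)) ⟩
    [ suc k₁ + suc k₂ ]₃ +₃ [ suc k₃ ]₃ +₃ 0F +₃ 1F
      ≡⟨ cong₂ (λ x y → x +₃ y +₃ 0F +₃ 1F) ([]₃-+ (suc k₁) (suc k₂)) ([]₃-+ 1 k₃) ⟩
    [ suc k₁ ]₃ +₃ [ suc k₂ ]₃ +₃ (1F +₃ [ k₃ ]₃) +₃ 0F +₃ 1F  ∎
    where open ≡-Reasoning

  module _ (dichotomy : TiltOrZeroSum) where

    tilted-leaves : ∀ {v} (M : Layout node v) {l} {g : Fin l → Node} → (∀ j s → g j ≢ node s) →
                    (∀ {y} → (∀ s → y ≢ v s) → Fresh y) →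
                    ZeroSumCopy ⊎ (∀ j → SameTilt (Layout.copy M ⟨ g j ⟩))
    tilted-leaves M g-far fresh = ⊎-all λ j → dichotomy _ (fresh (leaf-away M g-far j))

    -- p is the star centre and q one of its leaves: exchanging them shifts the weight by (d₃ − 1)·t.
    module AtHub (k₃≢0 : [ k₃ ]₃ ≢ 0F) (tilt≢0 : tilt ≢ 0F) where

      π : Vec (Fin 7) 6
      π = Ra ∷ Rb ∷ Rc ∷ Rd ∷ Rp ∷ Rq ∷ []

      M : Layout node (assign w π)
      M = layout node-injective (assign-injective π w-fresh _)

      ys : Fin k₃ → Fin (Fsize (suc k₁) 0 (suc k₂) (suc k₃))
      ys j = Layout.copy M ⟨ leaf₃ (Fin.suc j) ⟩

      conclude : (∀ j → SameTilt (ys j)) → ZeroSumCopy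
      conclude tilted = zero-sum-from-layouts M (swapped M 4F 5F) 1F 3F frame-unbalanced refl refl
        (swap-changes-weight M 4F 5F (≢-by-shift (star-shift₂ ys tilted) (·-nonzero k₃ tilt tilt≢0 k₃≢0)))

      zero-sum : ZeroSumCopy
      zero-sum = [ id , conclude ]′ (tilted-leaves M (far-by-decision (leaf₃ ∘ Fin.suc) (λ _ → _))
        λ away → (away 0F , away 1F , away 2F , away 3F) , away 4F , away 5F)

    -- p = p₁ with the leaf q and the neighbour a = p₂: exchanging p and q shifts the weight by d₁·t.
    module AtP₁ (d₁≢0 : [ suc k₁ ]₃ ≢ 0F) (tilt≢0 : tilt ≢ 0F) where

      π : Vec (Fin 7) 6
      π = Rp ∷ Rq ∷ Ra ∷ Rb ∷ Rc ∷ Rd ∷ []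

      M : Layout node (assign w π)
      M = layout node-injective (assign-injective π w-fresh _)

      ys : Fin k₁ → Fin (Fsize (suc k₁) 0 (suc k₂) (suc k₃))
      ys j = Layout.copy M ⟨ leaf₁ (Fin.suc j) ⟩

      conclude : (∀ j → SameTilt (ys j)) → ZeroSumCopy
      conclude tilted = zero-sum-from-layouts M (swapped M 0F 1F) 3F 5F frame-unbalanced refl refl
        (swap-changes-weight M 0F 1F (≢-by-shift (star-shift₃ ys tilted {col χ p a} {col χ q a} anchor-tilt′)
                                                  (·-nonzero (suc k₁) tilt tilt≢0 d₁≢0)))

      zero-sum : ZeroSumCopy
      zero-sum = [ id , conclude ]′ (tilted-leaves M (far-by-decision (leaf₁ ∘ Fin.suc) (λ _ → _))
        λ away → (away 2F , away 3F , away 4F , away 5F) , away 0F , away 1F)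

    -- p = p₂ with the leaf q and the neighbour a = p₁: exchanging p and q shifts the weight by d₂·t.
    module AtP₂ (d₂≢0 : [ suc k₂ ]₃ ≢ 0F) (tilt≢0 : tilt ≢ 0F) where

      π : Vec (Fin 7) 6
      π = Ra ∷ Rb ∷ Rp ∷ Rq ∷ Rc ∷ Rd ∷ []

      M : Layout node (assign w π)
      M = layout node-injective (assign-injective π w-fresh _)

      ys : Fin k₂ → Fin (Fsize (suc k₁) 0 (suc k₂) (suc k₃))
      ys j = Layout.copy M ⟨ leaf₂ (Fin.suc j) ⟩

      conclude : (∀ j → SameTilt (ys j)) → ZeroSumCopy
      conclude tilted = zero-sum-from-layouts M (swapped M 2F 3F) 1F 5F frame-unbalanced refl refl
        (swap-changes-weight M 2F 3F (≢-by-shift (star-shift₃ ys tilted {col χ a p} {col χ a q} anchor-tilt)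
                                                  (·-nonzero (suc k₂) tilt tilt≢0 d₂≢0)))

      zero-sum : ZeroSumCopy
      zero-sum = [ id , conclude ]′ (tilted-leaves M (far-by-decision (leaf₂ ∘ Fin.suc) (λ _ → _))
        λ away → (away 0F , away 1F , away 4F , away 5F) , away 2F , away 3F)

    with-nonzero-tilt : (tilt ≢ 0F → ZeroSumCopy) → ZeroSumCopy
    with-nonzero-tilt k = [ id , k ∘ tilt-nonzero ]′ (dichotomy w w-fresh)

    -- If d₃ ≡ 1 then d₁ + d₂ ≡ 1, so d₁ and d₂ are not both divisible by 3.
    zero-sum : [ suc k₁ + suc k₂ + suc k₃ + 0 + 1 ]₃ ≡ 0F → ZeroSumCopy
    zero-sum total with [ k₃ ]₃ ≟ 0F | [ suc k₁ ]₃ ≟ 0F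
    ... | no k₃≢0  | _        = with-nonzero-tilt (AtHub.zero-sum k₃≢0)
    ... | yes _    | no d₁≢0  = with-nonzero-tilt (AtP₁.zero-sum d₁≢0)
    ... | yes k₃≡0 | yes d₁≡0 =
      with-nonzero-tilt (AtP₂.zero-sum (last-residue _ _ _ (trans (sym residues) total) k₃≡0 d₁≡0))

module AnchorAtP₁ (k₁ k₂ k₃ : ℕ) (χ : Colouring (Fsize (2 + k₁) 0 (suc k₂) (suc k₃)))
                  (C : Configuration χ) where

  open Forest (2 + k₁) 0 (suc k₂) (suc k₃)
  open Copies (2 + k₁) 0 (suc k₂) (suc k₃) χ
  open Configuration C
  open Roles C

  shape : Shape
  shape = record
    { k              = 7
    ; node           = lookup nodes
    ; blocks         = edge 0F 5F
                     ∷ edge 0F 1F ∷ edge 0F 2F ∷ star 0F (leaf₁ ∘ Fin.suc ∘ Fin.suc)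
                     ∷ edge 5F 6F ∷ star 5F (leaf₂ ∘ Fin.suc)
                     ∷ edge 3F 4F ∷ star 3F (leaf₃ ∘ Fin.suc) ∷ []
    ; node-injective = lookup-injective-by-decision _≟ₙ_ nodes _
    ; far            = _ ∷ _ ∷ _ ∷ far-by-decision _ (λ _ → _) ∷ _ ∷ far-by-decision _ (λ _ → _)
                     ∷ _ ∷ far-by-decision _ (λ _ → _) ∷ []
    ; covers         = refl
    }
    where
    nodes : Vec Node 7
    nodes = spine 0F ∷ leaf₁ 0F ∷ leaf₁ 1F ∷ hub ∷ leaf₃ 0F ∷ spine 1F ∷ leaf₂ 0F ∷ []

  open Shape shape using (node; node-injective)
  open Swaps shape

  -- a = p₁ has the leaves b and q, y is the star centre with the leaf p, and d is a leaf of c = p₂: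
  -- exchanging p and q shifts the weight by col(y,q) − col(y,p) + col(a,p) − col(a,q).
  dichotomy : Spine₂.TiltOrZeroSum (suc k₁) k₂ k₃ χ C
  dichotomy y y-fresh = map₂ (tilt-from-balance (col χ a p) (col χ a q) (col χ y p) (col χ y q))
    (balanced-or-zero-sum L 1F 6F 2F 4F frame-unbalanced refl refl)
    where
    π : Vec (Fin 7) 7
    π = Ra ∷ Rb ∷ Rq ∷ Rx ∷ Rp ∷ Rc ∷ Rd ∷ []
    L : Layout node (assign y π)
    L = layout node-injective (assign-injective π y-fresh _)

module AnchorAtP₂ (k₁ k₂ k₃ : ℕ) (χ : Colouring (Fsize (suc k₁) 0 (2 + k₂) (suc k₃)))
                  (C : Configuration χ) where

  open Forest (suc k₁) 0 (2 + k₂) (suc k₃)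
  open Copies (suc k₁) 0 (2 + k₂) (suc k₃) χ
  open Configuration C
  open Roles C

  shape : Shape
  shape = record
    { k              = 7
    ; node           = lookup nodes
    ; blocks         = edge 5F 0F
                     ∷ edge 5F 6F ∷ star 5F (leaf₁ ∘ Fin.suc)
                     ∷ edge 0F 1F ∷ edge 0F 2F ∷ star 0F (leaf₂ ∘ Fin.suc ∘ Fin.suc)
                     ∷ edge 3F 4F ∷ star 3F (leaf₃ ∘ Fin.suc) ∷ []
    ; node-injective = lookup-injective-by-decision _≟ₙ_ nodes _
    ; far            = _ ∷ _ ∷ far-by-decision _ (λ _ → _) ∷ _ ∷ _ ∷ far-by-decision _ (λ _ → _)
                     ∷ _ ∷ far-by-decision _ (λ _ → _) ∷ []
    ; covers         = refl
    }
    where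
    nodes : Vec Node 7
    nodes = spine 1F ∷ leaf₂ 0F ∷ leaf₂ 1F ∷ hub ∷ leaf₃ 0F ∷ spine 0F ∷ leaf₁ 0F ∷ []

  open Shape shape using (node; node-injective)
  open Swaps shape

  -- As in AnchorAtP₁ with the roles of p₁ and p₂ exchanged.
  dichotomy : Spine₂.TiltOrZeroSum k₁ (suc k₂) k₃ χ C
  dichotomy y y-fresh = map₂ (tilt-from-balance (col χ a p) (col χ a q) (col χ y p) (col χ y q))
    (balanced-or-zero-sum L 1F 6F 2F 4F frame-unbalanced′ refl refl)
    where
    π : Vec (Fin 7) 7
    π = Ra ∷ Rb ∷ Rq ∷ Rx ∷ Rp ∷ Rc ∷ Rd ∷ []
    L : Layout node (assign y π)
    L = layout node-injective (assign-injective π y-fresh _)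

module AnchorAtHub (k₁ k₂ k₃ : ℕ) (χ : Colouring (Fsize (suc k₁) 0 (suc k₂) (2 + k₃)))
                   (C : Configuration χ) where

  open Forest (suc k₁) 0 (suc k₂) (2 + k₃)
  open Copies (suc k₁) 0 (suc k₂) (2 + k₃) χ
  open Configuration C
  open Roles C

  shape : Shape
  shape = record
    { k              = 7
    ; node           = lookup nodes
    ; blocks         = edge 3F 5F
                     ∷ edge 3F 4F ∷ star 3F (leaf₁ ∘ Fin.suc)
                     ∷ edge 5F 6F ∷ star 5F (leaf₂ ∘ Fin.suc)
                     ∷ edge 0F 1F ∷ edge 0F 2F ∷ star 0F (leaf₃ ∘ Fin.suc ∘ Fin.suc) ∷ []
    ; node-injective = lookup-injective-by-decision _≟ₙ_ nodes _
    ; far            = _ ∷ _ ∷ far-by-decision _ (λ _ → _) ∷ _ ∷ far-by-decision _ (λ _ → _)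
                     ∷ _ ∷ _ ∷ far-by-decision _ (λ _ → _) ∷ []
    ; covers         = refl
    }
    where
    nodes : Vec Node 7
    nodes = hub ∷ leaf₃ 0F ∷ leaf₃ 1F ∷ spine 0F ∷ leaf₁ 0F ∷ spine 1F ∷ leaf₂ 0F ∷ []

  open Shape shape using (node; node-injective)
  open Swaps shape

  -- As in AnchorAtP₁ with a the star centre, y = p₁ and c = p₂.
  dichotomy : Spine₂.TiltOrZeroSum k₁ k₂ (suc k₃) χ C
  dichotomy y y-fresh = map₂
    (tilt-from-balance (col χ a p) (col χ a q) (col χ y p) (col χ y q) ∘ commute)
    (balanced-or-zero-sum L 1F 6F 2F 4F frame-unbalanced′ refl refl)
    where
    π : Vec (Fin 7) 7
    π = Ra ∷ Rb ∷ Rq ∷ Rx ∷ Rp ∷ Rc ∷ Rd ∷ []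
    L : Layout node (assign y π)
    L = layout node-injective (assign-injective π y-fresh _)
    commute : Σ₃ (col χ y p ∷ col χ a q ∷ []) ≡ Σ₃ (col χ y q ∷ col χ a p ∷ []) →
              Σ₃ (col χ a q ∷ col χ y p ∷ []) ≡ Σ₃ (col χ a p ∷ col χ y q ∷ [])
    commute balanced = trans (Σ₃-swap _ _) (trans balanced (Σ₃-swap _ _))

-- The anchor a needs a centre with two leaves, which exists unless d₁ = d₂ = d₃ = 1, where 3 ∤ 4.
tilt-dichotomy : ∀ k₁ k₂ k₃ (χ : Colouring (Fsize (suc k₁) 0 (suc k₂) (suc k₃))) C →
                 [ suc k₁ + suc k₂ + suc k₃ + 0 + 1 ]₃ ≡ 0F → Spine₂.TiltOrZeroSum k₁ k₂ k₃ χ C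
tilt-dichotomy (suc k₁) k₂       k₃       χ C _ = AnchorAtP₁.dichotomy k₁ k₂ k₃ χ C
tilt-dichotomy zero     (suc k₂) k₃       χ C _ = AnchorAtP₂.dichotomy zero k₂ k₃ χ C
tilt-dichotomy zero     zero     (suc k₃) χ C _ = AnchorAtHub.dichotomy zero zero k₃ χ C
tilt-dichotomy zero     zero     zero     χ C ()

proposition4p22 : (d₁ d₂ d₃ m : ℕ) → 1 ≤ d₁ → 1 ≤ d₂ → 1 ≤ d₃ → m ≤ 2 →
    3 ∣ (d₁ + d₂ + d₃ + m + 1) →
    (χ : Colouring (Fsize d₁ m d₂ d₃)) →
    αC4≥1 χ →
    ∃[ a ] ∃[ b ] ∃[ c ] ∃[ d ] (Alternating χ a b c d × NotMonoOutside χ a b c d) →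
    ∃[ f ] (IsCopy (Fsize d₁ m d₂ d₃) f × copyColourSum χ f (Fedges d₁ m d₂ d₃) % 3 ≡ 0)
proposition4p22 zero _ _ _ () _ _ _ _ _ _ _
proposition4p22 (suc _) zero _ _ _ () _ _ _ _ _ _
proposition4p22 (suc _) (suc _) zero _ _ _ () _ _ _ _ _
proposition4p22 (suc k₁) (suc k₂) (suc k₃) 0 _ _ _ _ 3∣ χ _ (_ , _ , _ , _ , alt , not-mono) =
  Spine₂.zero-sum k₁ k₂ k₃ χ C (tilt-dichotomy k₁ k₂ k₃ χ C total) total
  where
  C : Configuration χ
  C = configuration χ alt not-mono
  total : [ suc k₁ + suc k₂ + suc k₃ + 0 + 1 ]₃ ≡ 0F
  total = residue-of-multiple 3∣
proposition4p22 1 (suc k₂) (suc k₃) 1 _ _ _ _ _ χ _ (_ , _ , _ , _ , alt , not-mono) =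
  Spine₃′.zero-sum k₂ k₃ χ (configuration χ alt not-mono)
proposition4p22 (suc (suc k₁)) (suc k₂) (suc k₃) 1 _ _ _ _ _ χ _ (_ , _ , _ , _ , alt , not-mono) =
  Spine₃.zero-sum k₁ (suc k₂) k₃ χ (configuration χ alt not-mono)
proposition4p22 (suc k₁) (suc k₂) (suc k₃) 2 _ _ _ _ _ χ _ (_ , _ , _ , _ , alt , not-mono) =
  Spine₄.zero-sum k₁ k₂ k₃ χ (configuration χ alt not-mono)
proposition4p22 (suc _) (suc _) (suc _) (suc (suc (suc _))) _ _ _ (s≤s (s≤s ())) _ _ _ _
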